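{- Let $G$ be a graph and $v_i\in V(G)$. Let $G_0$ be obtained from $G$ by adding a new vertex $v_{n+1}\notin V(G)$ and the pendant edge $v_iv_{n+1}$. Then $H(G_0)>H(G)$.
   Context: Graphs are finite, simple and undirected. For a graph $G$ with vertex degrees $d_i=\deg(v_i)$ (in $G$), the Harmonic index is $H(G)=\sum_{v_iv_j\in E(G)} \frac{2}{d_i+d_j}$, the sum being over all edges. -}

module Defs where

open import Data.Bool using (Bool; true; false; if_then_else_; _∧_)
open import Data.Nat using (ℕ; zero; suc; _+_; _<ᵇ_)
open import Data.Fin using (Fin; zero; suc; toℕ; _≟_)
open import Data.List using (List; map; foldr; allFin)
open import Data.Nat.ListAction using (sum)
open import Data.Integer using (+_)
open import Data.Rational using (ℚ; 0ℚ; _/_) renaming (_+_ to _+ℚ_)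
open import Relation.Nullary.Decidable using (⌊_⌋)
open import Relation.Binary.PropositionalEquality using (_≡_)

record Graph (n : ℕ) : Set where
  field
    adj    : Fin n → Fin n → Bool
    sym    : ∀ i j → adj i j ≡ adj j i
    irrefl : ∀ i → adj i i ≡ false
open Graph public

deg : ∀ {n} → Graph n → Fin n → ℕ
deg {n} G i = sum (map (λ j → if adj G i j then 1 else 0) (allFin n))

sumℚ : List ℚ → ℚ
sumℚ = foldr _+ℚ_ 0ℚ

-- 2 / m as a rational (m = d_i + d_j ≥ 2 on every edge; the m = 0 case never
-- occurs for an edge and is set to 0 only to make the function total)
twoOver : ℕ → ℚ
twoOver zero    = 0ℚ
twoOver (suc m) = (+ 2) / suc m

edgeTerm : ∀ {n} → Graph n → Fin n → Fin n → ℚ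
edgeTerm G i j =
  if adj G i j ∧ (toℕ i <ᵇ toℕ j) then twoOver (deg G i + deg G j) else 0ℚ

H : ∀ {n} → Graph n → ℚ
H {n} G = sumℚ (map (λ i → sumℚ (map (λ j → edgeTerm G i j) (allFin n))) (allFin n))

-- G₀: add a new vertex (index zero of Fin (suc n); old vertex v becomes suc v)
-- and the pendant edge between the new vertex and v_i.
pendAdj : ∀ {n} → Graph n → Fin n → Fin (suc n) → Fin (suc n) → Bool
pendAdj G i zero    zero    = false
pendAdj G i zero    (suc b) = ⌊ b ≟ i ⌋
pendAdj G i (suc a) zero    = ⌊ a ≟ i ⌋
pendAdj G i (suc a) (suc b) = adj G a b

pendSym : ∀ {n} (G : Graph n) (i : Fin n) a b → pendAdj G i a b ≡ pendAdj G i b a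
pendSym G i zero    zero    = Relation.Binary.PropositionalEquality.refl
pendSym G i zero    (suc b) = Relation.Binary.PropositionalEquality.refl
pendSym G i (suc a) zero    = Relation.Binary.PropositionalEquality.refl
pendSym G i (suc a) (suc b) = sym G a b

pendIrrefl : ∀ {n} (G : Graph n) (i : Fin n) a → pendAdj G i a a ≡ false
pendIrrefl G i zero    = Relation.Binary.PropositionalEquality.refl
pendIrrefl G i (suc a) = irrefl G a

addPendant : ∀ {n} → Graph n → Fin n → Graph (suc n)
addPendant G i = record
  { adj = pendAdj G i ; sym = pendSym G i ; irrefl = pendIrrefl G i }

-- Adding a pendant edge at v_i creates the new edge term 2/(d+2), d = deg v_i, and only
-- lowers the terms of the d edges at v_i, each from 2/M to 2/(M+1) with M ≥ d+1.  Each such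
-- loss 2/(M(M+1)) is at most 2/((d+1)(d+2)), so the total loss is at most
-- 2d/((d+1)(d+2)) < 2/(d+2).
module Submission where

open import Algebra.Bundles using (Monoid)
open import Data.Bool using (Bool; true; false; if_then_else_; _∧_)
open import Data.Bool.Properties using (∧-identityʳ; ∧-zeroʳ)
open import Data.Fin using (Fin; zero; suc; toℕ; _≟_)
open import Data.Integer as ℤ using (+_)
import Data.Integer.Properties as ℤ
open import Data.List as List using (allFin)
open import Data.List.Properties using (map-tabulate)
open import Data.Nat as ℕ using (ℕ; zero; suc; z≤n; s≤s; _<ᵇ_)
import Data.Nat.Properties as ℕ
open import Data.Nat.Tactic.RingSolver using (solve-∀)
open import Data.Rational using (ℚ; 0ℚ; _/_; _+_; _≤_; _<_; toℚᵘ)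
import Data.Rational.Properties as ℚ
open import Data.Rational.Unnormalised as ℚᵘ using (mkℚᵘ; _≃_; *≡*; *≤*; *<*)
import Data.Rational.Unnormalised.Properties as ℚᵘ
import Data.Vec.Functional as Vector
open import Data.Product using (_×_; _,_)
open import Data.Sum using (_⊎_; inj₁; inj₂)
open import Function using (_∘_; id)
open import Relation.Nullary.Negation using (contradiction)
open import Relation.Nullary.Decidable using (⌊_⌋; yes; no; dec-true; isYes≗does; ⌊⌋-map′)
open import Relation.Binary.PropositionalEquality as ≡ using (_≡_; refl; cong; cong₂; subst; subst₂)

open import Defs renaming (sym to adj-sym)

𝟙 : Bool → ℕ
𝟙 c = if c then 1 else 0

𝟙-<ᵇ-asym : ∀ x y → 𝟙 (x <ᵇ y) ℕ.+ 𝟙 (y <ᵇ x) ℕ.≤ 1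
𝟙-<ᵇ-asym zero    zero    = z≤n
𝟙-<ᵇ-asym zero    (suc y) = s≤s z≤n
𝟙-<ᵇ-asym (suc x) zero    = s≤s z≤n
𝟙-<ᵇ-asym (suc x) (suc y) = 𝟙-<ᵇ-asym x y

𝟙-∧-<ᵇ-≤ : ∀ e x y → 𝟙 (e ∧ (x <ᵇ y)) ℕ.+ 𝟙 (e ∧ (y <ᵇ x)) ℕ.≤ 𝟙 e
𝟙-∧-<ᵇ-≤ true  x y = 𝟙-<ᵇ-asym x y
𝟙-∧-<ᵇ-≤ false x y = z≤n

*-𝟙 : ∀ x c → x ℕ.* 𝟙 c ≡ (if c then x else 0)
*-𝟙 x true  = ℕ.*-identityʳ x
*-𝟙 x false = ℕ.*-zeroʳ x

if-+-𝟙 : ∀ c x y → (if c then x ℕ.+ y else 0) ≡ 𝟙 c ℕ.* x ℕ.+ 𝟙 c ℕ.* y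
if-+-𝟙 true  x y = ≡.sym (cong₂ ℕ._+_ (ℕ.*-identityˡ x) (ℕ.*-identityˡ y))
if-+-𝟙 false x y = refl

foldr-map-allFin : ∀ {A : Set} (_∙_ : A → A → A) (ε : A) {n} (f : Fin n → A) →
                   List.foldr _∙_ ε (List.map f (allFin n)) ≡ Vector.foldr _∙_ ε f
foldr-map-allFin _∙_ ε {zero}  f = refl
foldr-map-allFin _∙_ ε {suc n} f = cong (f zero ∙_) (begin
  List.foldr _∙_ ε (List.map f (List.tabulate suc))  ≡⟨ cong (List.foldr _∙_ ε) (map-tabulate suc f) ⟩
  List.foldr _∙_ ε (List.tabulate (f ∘ suc))         ≡⟨ cong (List.foldr _∙_ ε) (map-tabulate id (f ∘ suc)) ⟨
  List.foldr _∙_ ε (List.map (f ∘ suc) (allFin n))   ≡⟨ foldr-map-allFin _∙_ ε (f ∘ suc) ⟩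
  Vector.foldr _∙_ ε (f ∘ suc)                       ∎)
  where open ≡.≡-Reasoning

module _ {c ℓ} (M : Monoid c ℓ) where
  open Monoid M
  open import Algebra.Properties.Monoid.Sum M using (sum; sum-cong-≗; sum-replicate-zero)

  ∑-select : ∀ {n} (i : Fin n) (f : Fin n → Carrier) → sum (λ j → if ⌊ j ≟ i ⌋ then f j else ε) ≈ f i
  ∑-select {suc n} zero    f = trans (∙-congˡ (sum-replicate-zero n)) (identityʳ (f zero))
  ∑-select         (suc i) f = trans (identityˡ _) (trans (reflexive (sum-cong-≗ select-tail)) (∑-select i (f ∘ suc)))
    where
    select-tail : ∀ j → (if ⌊ suc j ≟ suc i ⌋ then f (suc j) else ε) ≡ (if ⌊ j ≟ i ⌋ then f (suc j) else ε)
    select-tail j = cong (λ b → if b then f (suc j) else ε) (⌊⌋-map′ _ _ (j ≟ i))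

open import Algebra.Properties.CommutativeMonoid.Sum ℕ.+-0-commutativeMonoid
  using () renaming (sum to ∑ℕ; sum-cong-≗ to ∑ℕ-cong; ∑-distrib-+ to ∑ℕ-distrib-+; sum-remove to ∑ℕ-remove)
open import Algebra.Properties.Semiring.Sum ℕ.+-*-semiring
  using (*-distribˡ-sum; *-distribʳ-sum)
open import Algebra.Properties.CommutativeMonoid.Sum ℚ.+-0-commutativeMonoid
  using () renaming (sum to ∑ℚ; sum-cong-≗ to ∑ℚ-cong; ∑-distrib-+ to ∑ℚ-distrib-+)

∑ℕ-select : ∀ {n} (i : Fin n) (f : Fin n → ℕ) → ∑ℕ (λ j → f j ℕ.* 𝟙 ⌊ j ≟ i ⌋) ≡ f i
∑ℕ-select i f = ≡.trans (∑ℕ-cong (λ j → *-𝟙 (f j) ⌊ j ≟ i ⌋)) (∑-select ℕ.+-0-monoid i f)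

∑ℕ-mono-≤ : ∀ {n} {f g : Fin n → ℕ} → (∀ j → f j ℕ.≤ g j) → ∑ℕ f ℕ.≤ ∑ℕ g
∑ℕ-mono-≤ {zero}  f≤g = z≤n
∑ℕ-mono-≤ {suc n} f≤g = ℕ.+-mono-≤ (f≤g zero) (∑ℕ-mono-≤ (f≤g ∘ suc))

∑ℚ-mono-≤ : ∀ {n} {f g : Fin n → ℚ} → (∀ j → f j ≤ g j) → ∑ℚ f ≤ ∑ℚ g
∑ℚ-mono-≤ {zero}  f≤g = ℚ.≤-refl
∑ℚ-mono-≤ {suc n} f≤g = ℚ.+-mono-≤ (f≤g zero) (∑ℚ-mono-≤ (f≤g ∘ suc))

toℚᵘ-/suc : ∀ a b → toℚᵘ ((+ a) / suc b) ≃ mkℚᵘ (+ a) b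
toℚᵘ-/suc a b = ℚ.toℚᵘ-fromℚᵘ (mkℚᵘ (+ a) b)

/suc-≡ : ∀ a b c e → a ℕ.* suc e ≡ c ℕ.* suc b → (+ a) / suc b ≡ (+ c) / suc e
/suc-≡ a b c e eq =
  ℚ.fromℚᵘ-cong {mkℚᵘ (+ a) b} {mkℚᵘ (+ c) e}
    (*≡* (≡.trans (≡.sym (ℤ.pos-* a (suc e))) (≡.trans (cong +_ eq) (ℤ.pos-* c (suc b)))))

/suc-≤ : ∀ a b c e → a ℕ.* suc e ℕ.≤ c ℕ.* suc b → (+ a) / suc b ≤ (+ c) / suc e
/suc-≤ a b c e le = ℚ.toℚᵘ-cancel-≤
  (ℚᵘ.≤-respˡ-≃ (ℚᵘ.≃-sym (toℚᵘ-/suc a b)) (ℚᵘ.≤-respʳ-≃ (ℚᵘ.≃-sym (toℚᵘ-/suc c e))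
    (*≤* (subst₂ ℤ._≤_ (ℤ.pos-* a (suc e)) (ℤ.pos-* c (suc b)) (ℤ.+≤+ le)))))

/suc-< : ∀ a b c e → a ℕ.* suc e ℕ.< c ℕ.* suc b → (+ a) / suc b < (+ c) / suc e
/suc-< a b c e lt = ℚ.toℚᵘ-cancel-<
  (ℚᵘ.<-respˡ-≃ (ℚᵘ.≃-sym (toℚᵘ-/suc a b)) (ℚᵘ.<-respʳ-≃ (ℚᵘ.≃-sym (toℚᵘ-/suc c e))
    (*<* (subst₂ ℤ._<_ (ℤ.pos-* a (suc e)) (ℤ.pos-* c (suc b)) (ℤ.+<+ lt)))))

/suc-+ : ∀ a b c e → (+ a) / suc b + (+ c) / suc e ≡ (+ (a ℕ.* suc e ℕ.+ c ℕ.* suc b)) / (suc b ℕ.* suc e)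
/suc-+ a b c e = ℚ.toℚᵘ-injective (begin-equality
  toℚᵘ ((+ a) / suc b + (+ c) / suc e)            ≃⟨ ℚ.toℚᵘ-homo-+ ((+ a) / suc b) ((+ c) / suc e) ⟩
  toℚᵘ ((+ a) / suc b) ℚᵘ.+ toℚᵘ ((+ c) / suc e)  ≃⟨ ℚᵘ.+-cong (toℚᵘ-/suc a b) (toℚᵘ-/suc c e) ⟩
  mkℚᵘ (+ a) b ℚᵘ.+ mkℚᵘ (+ c) e                  ≡⟨ cong (λ z → mkℚᵘ z (e ℕ.+ b ℕ.* suc e)) numerator ⟩
  mkℚᵘ (+ (a ℕ.* suc e ℕ.+ c ℕ.* suc b)) _        ≃⟨ toℚᵘ-/suc _ _ ⟨
  toℚᵘ ((+ (a ℕ.* suc e ℕ.+ c ℕ.* suc b)) / (suc b ℕ.* suc e)) ∎)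
  where
  open ℚᵘ.≤-Reasoning
  numerator : + a ℤ.* + suc e ℤ.+ + c ℤ.* + suc b ≡ + (a ℕ.* suc e ℕ.+ c ℕ.* suc b)
  numerator = ≡.sym (≡.trans (ℤ.pos-+ (a ℕ.* suc e) (c ℕ.* suc b)) (cong₂ ℤ._+_ (ℤ.pos-* a (suc e)) (ℤ.pos-* c (suc b))))

/suc-+-same : ∀ a c b → (+ a) / suc b + (+ c) / suc b ≡ (+ (a ℕ.+ c)) / suc b
/suc-+-same a c b = ≡.trans (/suc-+ a b c b) (/suc-≡ (a ℕ.* suc b ℕ.+ c ℕ.* suc b) (b ℕ.+ b ℕ.* suc b) (a ℕ.+ c) b (begin
  (a ℕ.* suc b ℕ.+ c ℕ.* suc b) ℕ.* suc b  ≡⟨ cong (ℕ._* suc b) (ℕ.*-distribʳ-+ (suc b) a c) ⟨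
  (a ℕ.+ c) ℕ.* suc b ℕ.* suc b            ≡⟨ ℕ.*-assoc (a ℕ.+ c) (suc b) (suc b) ⟩
  (a ℕ.+ c) ℕ.* (suc b ℕ.* suc b)          ∎))
  where open ≡.≡-Reasoning

∑ℚ-/suc : ∀ {n} (f : Fin n → ℕ) b → ∑ℚ (λ j → (+ f j) / suc b) ≡ (+ ∑ℕ f) / suc b
∑ℚ-/suc {zero}  f b = ≡.sym (ℚ.0/n≡0 (suc b))
∑ℚ-/suc {suc n} f b = ≡.trans (cong (λ s → (+ f zero) / suc b + s) (∑ℚ-/suc (f ∘ suc) b)) (/suc-+-same (f zero) _ b)

twoOver-gap : ∀ {m M} → suc m ℕ.≤ M → twoOver M ≤ twoOver (suc M) + (+ 2) / (suc m ℕ.* suc (suc m))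
twoOver-gap {m} {suc M} m<M =
  subst (twoOver (suc M) ≤_) (≡.sym (/suc-+ 2 (suc M) 2 e))
    (/suc-≤ 2 M (2 ℕ.* E ℕ.+ 2 ℕ.* suc (suc M)) (e ℕ.+ suc M ℕ.* E) (begin
      2 ℕ.* (suc (suc M) ℕ.* E)                              ≡⟨ lhs-expand (suc M) E ⟩
      2 ℕ.* (suc M ℕ.* E) ℕ.+ 2 ℕ.* E                        ≤⟨ ℕ.+-monoʳ-≤ (2 ℕ.* (suc M ℕ.* E)) (ℕ.*-monoʳ-≤ 2 E≤M[M+1]) ⟩
      2 ℕ.* (suc M ℕ.* E) ℕ.+ 2 ℕ.* (suc M ℕ.* suc (suc M))  ≡⟨ rhs-expand (suc M) E ⟨
      (2 ℕ.* E ℕ.+ 2 ℕ.* suc (suc M)) ℕ.* suc M              ∎))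
  where
  open ℕ.≤-Reasoning
  e E : ℕ
  e = suc m ℕ.+ m ℕ.* suc (suc m)
  E = suc e
  E≤M[M+1] : E ℕ.≤ suc M ℕ.* suc (suc M)
  E≤M[M+1] = ℕ.*-mono-≤ m<M (s≤s m<M)
  lhs-expand : ∀ x y → 2 ℕ.* ((1 ℕ.+ x) ℕ.* y) ≡ 2 ℕ.* (x ℕ.* y) ℕ.+ 2 ℕ.* y
  lhs-expand = solve-∀
  rhs-expand : ∀ x y → (2 ℕ.* y ℕ.+ 2 ℕ.* (1 ℕ.+ x)) ℕ.* x ≡ 2 ℕ.* (x ℕ.* y) ℕ.+ 2 ℕ.* (x ℕ.* (1 ℕ.+ x))
  rhs-expand = solve-∀

twoOver-dominates : ∀ {k d} → k ℕ.≤ d → (+ (2 ℕ.* k)) / (suc d ℕ.* suc (suc d)) < twoOver (suc (suc d))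
twoOver-dominates {k} {d} k≤d = /suc-< (2 ℕ.* k) (suc d ℕ.+ d ℕ.* suc (suc d)) 2 (suc d) (begin-strict
  2 ℕ.* k ℕ.* suc (suc d)          ≤⟨ ℕ.*-monoˡ-≤ (suc (suc d)) (ℕ.*-monoʳ-≤ 2 k≤d) ⟩
  2 ℕ.* d ℕ.* suc (suc d)          ≡⟨ ℕ.*-assoc 2 d (suc (suc d)) ⟩
  2 ℕ.* (d ℕ.* suc (suc d))        <⟨ ℕ.*-monoʳ-< 2 (ℕ.m<n+m (d ℕ.* suc (suc d)) {suc (suc d)} ℕ.z<s) ⟩
  2 ℕ.* (suc d ℕ.* suc (suc d))    ∎)
  where open ℕ.≤-Reasoning

≤-+-0/ : ∀ x b .{{_ : ℕ.NonZero b}} → x ≤ x + (+ 0) / b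
≤-+-0/ x b = ℚ.≤-reflexive (≡.sym (≡.trans (cong (λ y → x + y) (ℚ.0/n≡0 b)) (ℚ.+-identityʳ x)))

twoOver-shift : ∀ {m M s} → s ≡ 0 ⊎ (s ≡ 1 × suc m ℕ.≤ M) →
                twoOver M ≤ twoOver (s ℕ.+ M) + (+ (2 ℕ.* s)) / (suc m ℕ.* suc (suc m))
twoOver-shift {m} (inj₁ refl)     = ≤-+-0/ _ (suc m ℕ.* suc (suc m))
twoOver-shift (inj₂ (refl , m<M)) = twoOver-gap m<M

deg-∑ : ∀ {n} (G : Graph n) a → deg G a ≡ ∑ℕ (λ j → 𝟙 (adj G a j))
deg-∑ G a = foldr-map-allFin ℕ._+_ 0 (λ j → 𝟙 (adj G a j))

H-∑ : ∀ {n} (G : Graph n) → H G ≡ ∑ℚ (λ a → ∑ℚ (edgeTerm G a))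
H-∑ {n} G = ≡.trans (foldr-map-allFin _+_ 0ℚ (λ a → sumℚ (List.map (edgeTerm G a) (allFin n))))
                    (∑ℚ-cong (λ a → foldr-map-allFin _+_ 0ℚ (edgeTerm G a)))

deg-pos : ∀ {n} (G : Graph n) {a b} → adj G a b ≡ true → 0 ℕ.< deg G a
deg-pos {suc n} G {a} {b} ab = begin
  1                                 ≡⟨ cong 𝟙 ab ⟨
  𝟙 (adj G a b)                     ≤⟨ ℕ.m≤m+n _ _ ⟩
  𝟙 (adj G a b) ℕ.+ _               ≡⟨ ∑ℕ-remove {i = b} (λ j → 𝟙 (adj G a j)) ⟨
  ∑ℕ (λ j → 𝟙 (adj G a j))          ≡⟨ deg-∑ G a ⟨
  deg G a                           ∎
  where open ℕ.≤-Reasoning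

module PendantVertex {n} (G : Graph n) (i : Fin n) where

  G₀ : Graph (suc n)
  G₀ = addPendant G i

  d : ℕ
  d = deg G i

  δᵢ : Fin n → ℕ
  δᵢ a = 𝟙 ⌊ a ≟ i ⌋

  forward : Fin n → Fin n → Bool
  forward a b = adj G a b ∧ (toℕ a <ᵇ toℕ b)

  endsAtᵢ : Fin n → Fin n → ℕ
  endsAtᵢ a b = if forward a b then δᵢ a ℕ.+ δᵢ b else 0

  deg₀-new : deg G₀ zero ≡ 1
  deg₀-new = ≡.trans (deg-∑ G₀ zero) (∑-select ℕ.+-0-monoid i (λ _ → 1))

  deg₀-old : ∀ a → deg G₀ (suc a) ≡ δᵢ a ℕ.+ deg G a
  deg₀-old a = ≡.trans (deg-∑ G₀ (suc a)) (cong (δᵢ a ℕ.+_) (≡.sym (deg-∑ G a)))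

  δᵢ-self : δᵢ i ≡ 1
  δᵢ-self = cong 𝟙 (≡.trans (isYes≗does (i ≟ i)) (dec-true (i ≟ i) refl))

  oldRow : Fin n → ℚ
  oldRow a = ∑ℚ (λ b → edgeTerm G₀ (suc a) (suc b))

  H₀-old : ℚ
  H₀-old = ∑ℚ oldRow

  H₀-split : H G₀ ≡ twoOver (suc (suc d)) + H₀-old
  H₀-split = ≡.trans (H-∑ G₀) (cong₂ _+_ (≡.trans (ℚ.+-identityˡ _) pendant-row) (∑ℚ-cong old-row))
    where
    pendant-row : ∑ℚ (λ b → edgeTerm G₀ zero (suc b)) ≡ twoOver (suc (suc d))
    pendant-row = begin
      ∑ℚ (λ b → edgeTerm G₀ zero (suc b))
        ≡⟨ ∑ℚ-cong (λ b → cong (λ c → if c then twoOver (deg G₀ zero ℕ.+ deg G₀ (suc b)) else 0ℚ)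
                                (∧-identityʳ ⌊ b ≟ i ⌋)) ⟩
      ∑ℚ (λ b → if ⌊ b ≟ i ⌋ then twoOver (deg G₀ zero ℕ.+ deg G₀ (suc b)) else 0ℚ)
        ≡⟨ ∑-select ℚ.+-0-monoid i (λ b → twoOver (deg G₀ zero ℕ.+ deg G₀ (suc b))) ⟩
      twoOver (deg G₀ zero ℕ.+ deg G₀ (suc i))
        ≡⟨ cong twoOver (cong₂ ℕ._+_ deg₀-new (≡.trans (deg₀-old i) (cong (ℕ._+ d) δᵢ-self))) ⟩
      twoOver (suc (suc d)) ∎
      where open ≡.≡-Reasoning
    old-row : ∀ a → edgeTerm G₀ (suc a) zero + oldRow a ≡ oldRow a
    old-row a = ≡.trans (cong (λ c → (if c then twoOver (deg G₀ (suc a) ℕ.+ deg G₀ zero) else 0ℚ) + oldRow a)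
                              (∧-zeroʳ ⌊ a ≟ i ⌋))
                        (ℚ.+-identityˡ (oldRow a))

  D : ℕ
  D = suc d ℕ.* suc (suc d)

  edge-endsAtᵢ : ∀ {a b} → adj G a b ≡ true →
    δᵢ a ℕ.+ δᵢ b ≡ 0 ⊎ (δᵢ a ℕ.+ δᵢ b ≡ 1 × suc d ℕ.≤ deg G a ℕ.+ deg G b)
  edge-endsAtᵢ {a} {b} ab with a ≟ i | b ≟ i
  ... | yes refl | yes refl = contradiction (≡.trans (≡.sym ab) (irrefl G a)) λ ()
  ... | yes refl | no _     = inj₂ (refl , ℕ.m<m+n d (deg-pos G (≡.trans (adj-sym G b a) ab)))
  ... | no _     | yes refl = inj₂ (refl , ℕ.m<n+m d (deg-pos G ab))
  ... | no _     | no _     = inj₁ refl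

  edge-bound : ∀ a b → adj G a b ≡ true →
    twoOver (deg G a ℕ.+ deg G b) ≤ twoOver (deg G₀ (suc a) ℕ.+ deg G₀ (suc b)) + (+ (2 ℕ.* (δᵢ a ℕ.+ δᵢ b))) / D
  edge-bound a b ab =
    subst (λ M → twoOver (deg G a ℕ.+ deg G b) ≤ twoOver M + (+ (2 ℕ.* (δᵢ a ℕ.+ δᵢ b))) / D)
          (≡.sym new-degrees) (twoOver-shift (edge-endsAtᵢ ab))
    where
    new-degrees : deg G₀ (suc a) ℕ.+ deg G₀ (suc b) ≡ (δᵢ a ℕ.+ δᵢ b) ℕ.+ (deg G a ℕ.+ deg G b)
    new-degrees = ≡.trans (cong₂ ℕ._+_ (deg₀-old a) (deg₀-old b)) (interchange (δᵢ a) (deg G a) (δᵢ b) (deg G b))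
      where
      interchange : ∀ x u y v → (x ℕ.+ u) ℕ.+ (y ℕ.+ v) ≡ (x ℕ.+ y) ℕ.+ (u ℕ.+ v)
      interchange = solve-∀

  -- Splitting on the Booleans by pattern matching keeps the rational goal from being normalised,
  -- which a 'with' on 'forward a b' would do.
  forward-bound : ∀ p q {x y : ℚ} {k} → (p ≡ true → x ≤ y + (+ (2 ℕ.* k)) / D) →
    (if p ∧ q then x else 0ℚ) ≤ (if p ∧ q then y else 0ℚ) + (+ (2 ℕ.* (if p ∧ q then k else 0))) / D
  forward-bound true  true  x≤y = x≤y refl
  forward-bound true  false x≤y = ≤-+-0/ 0ℚ D
  forward-bound false q     x≤y = ≤-+-0/ 0ℚ D

  edgeTerm-bound : ∀ a b → edgeTerm G a b ≤ edgeTerm G₀ (suc a) (suc b) + (+ (2 ℕ.* endsAtᵢ a b)) / D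
  edgeTerm-bound a b = forward-bound (adj G a b) (toℕ a <ᵇ toℕ b) (edge-bound a b)

  forward-either-≤ : ∀ b → 𝟙 (forward i b) ℕ.+ 𝟙 (forward b i) ℕ.≤ 𝟙 (adj G i b)
  forward-either-≤ b rewrite adj-sym G b i = 𝟙-∧-<ᵇ-≤ (adj G i b) (toℕ i) (toℕ b)

  ends-total : ℕ
  ends-total = ∑ℕ (λ a → ∑ℕ (endsAtᵢ a))

  ends-total-≤ : ends-total ℕ.≤ d
  ends-total-≤ = begin
    ∑ℕ (λ a → ∑ℕ (endsAtᵢ a))
      ≡⟨ ∑ℕ-cong (λ a → ≡.trans (∑ℕ-cong (λ b → if-+-𝟙 (forward a b) (δᵢ a) (δᵢ b)))
                                (∑ℕ-distrib-+ (atTail a) (atHead a))) ⟩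
    ∑ℕ (λ a → ∑ℕ (atTail a) ℕ.+ ∑ℕ (atHead a))
      ≡⟨ ∑ℕ-distrib-+ (λ a → ∑ℕ (atTail a)) (λ a → ∑ℕ (atHead a)) ⟩
    ∑ℕ (λ a → ∑ℕ (atTail a)) ℕ.+ ∑ℕ (λ a → ∑ℕ (atHead a))
      ≡⟨ cong₂ ℕ._+_ (≡.trans (∑ℕ-cong (λ a → ≡.sym (*-distribʳ-sum (δᵢ a) (λ b → 𝟙 (forward a b)))))
                              (∑ℕ-select i (λ a → ∑ℕ (λ b → 𝟙 (forward a b)))))
                     (∑ℕ-cong (λ a → ∑ℕ-select i (λ b → 𝟙 (forward a b)))) ⟩
    ∑ℕ (λ b → 𝟙 (forward i b)) ℕ.+ ∑ℕ (λ b → 𝟙 (forward b i))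
      ≡⟨ ∑ℕ-distrib-+ (λ b → 𝟙 (forward i b)) (λ b → 𝟙 (forward b i)) ⟨
    ∑ℕ (λ b → 𝟙 (forward i b) ℕ.+ 𝟙 (forward b i))
      ≤⟨ ∑ℕ-mono-≤ forward-either-≤ ⟩
    ∑ℕ (λ b → 𝟙 (adj G i b))
      ≡⟨ deg-∑ G i ⟨
    d ∎
    where
    open ℕ.≤-Reasoning
    atTail atHead : Fin n → Fin n → ℕ
    atTail a b = 𝟙 (forward a b) ℕ.* δᵢ a
    atHead a b = 𝟙 (forward a b) ℕ.* δᵢ b

  excess : Fin n → Fin n → ℚ
  excess a b = (+ (2 ℕ.* endsAtᵢ a b)) / D

  excess-total : ∑ℚ (λ a → ∑ℚ (excess a)) ≡ (+ (2 ℕ.* ends-total)) / D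
  excess-total = begin
    ∑ℚ (λ a → ∑ℚ (excess a))
      ≡⟨ ∑ℚ-cong (λ a → ∑ℚ-/suc (λ b → 2 ℕ.* endsAtᵢ a b) D-1) ⟩
    ∑ℚ (λ a → (+ ∑ℕ (λ b → 2 ℕ.* endsAtᵢ a b)) / D)
      ≡⟨ ∑ℚ-/suc (λ a → ∑ℕ (λ b → 2 ℕ.* endsAtᵢ a b)) D-1 ⟩
    (+ ∑ℕ (λ a → ∑ℕ (λ b → 2 ℕ.* endsAtᵢ a b))) / D
      ≡⟨ cong (λ m → (+ m) / D) (≡.trans (*-distribˡ-sum 2 (λ a → ∑ℕ (endsAtᵢ a)))
                                         (∑ℕ-cong (λ a → *-distribˡ-sum 2 (endsAtᵢ a)))) ⟨
    (+ (2 ℕ.* ends-total)) / D ∎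
    where
    open ≡.≡-Reasoning
    D-1 : ℕ
    D-1 = suc d ℕ.+ d ℕ.* suc (suc d)

  H-≤ : H G ≤ H₀-old + (+ (2 ℕ.* ends-total)) / D
  H-≤ = begin
    H G
      ≡⟨ H-∑ G ⟩
    ∑ℚ (λ a → ∑ℚ (edgeTerm G a))
      ≤⟨ ∑ℚ-mono-≤ (λ a → ∑ℚ-mono-≤ (edgeTerm-bound a)) ⟩
    ∑ℚ (λ a → ∑ℚ (λ b → edgeTerm G₀ (suc a) (suc b) + excess a b))
      ≡⟨ ≡.trans (∑ℚ-cong (λ a → ∑ℚ-distrib-+ (λ b → edgeTerm G₀ (suc a) (suc b)) (excess a)))
                 (∑ℚ-distrib-+ oldRow (λ a → ∑ℚ (excess a))) ⟩
    H₀-old + ∑ℚ (λ a → ∑ℚ (excess a))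
      ≡⟨ cong (λ s → H₀-old + s) excess-total ⟩
    H₀-old + (+ (2 ℕ.* ends-total)) / D ∎
    where open ℚ.≤-Reasoning

lemma1 : ∀ {n : ℕ} (G : Graph n) (i : Fin n) → H G < H (addPendant G i)
lemma1 G i = begin-strict
  H G                                         ≤⟨ H-≤ ⟩
  H₀-old + (+ (2 ℕ.* ends-total)) / D         <⟨ ℚ.+-monoʳ-< H₀-old (twoOver-dominates ends-total-≤) ⟩
  H₀-old + twoOver (suc (suc d))              ≡⟨ ℚ.+-comm H₀-old _ ⟩
  twoOver (suc (suc d)) + H₀-old              ≡⟨ H₀-split ⟨
  H (addPendant G i)                          ∎
  where
  open PendantVertex G i
  open ℚ.≤-Reasoning
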